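{- Let $W$ be a set of eight distinct MacMahon cubes with $\mathrm{Ba}\in W$ such that $G_W$ has seven edges. If $G_W$ has exactly two connected components, then one of the components is a tree with $k$ edges for some $k\in\{0,1,2,3,4,5\}$, and the solution number of $W$ for the target $\mathrm{Ba}$ is $2(k+1)$.
   Context: A MacMahon cube is a cube whose six faces are painted with the colors $1,\dots,6$, each used once, up to rotation (there are $30$ of them). At each vertex three faces meet; reading their colors clockwise as seen from outside gives a cyclic triple, and the corner number of the vertex is the cyclic rotation of this triple of smallest three-digit value; each MacMahon cube has $8$ distinct corner numbers. $\mathrm{Ba}$ denotes the MacMahon cube whose corner numbers are $\{123,134,146,162,253,265,354,456\}$. Every MacMahon cube other than $\mathrm{Ba}$ shares either $0$ or exactly $2$ corner numbers with $\mathrm{Ba}$. $M$ is the multigraph whose vertex set is the $8$ corner numbers of $\mathrm{Ba}$, with one edge, labeled $C$, joining the two shared corner numbers for each MacMahon cube $C\neq\mathrm{Ba}$ sharing exactly two corner numbers with $\mathrm{Ba}$ ($20$ edges, no loops, some parallel pairs). For a set $W$ of MacMahon cubes, $G_W$ is the subgraph of $M$ with all $8$ vertices and exactly the edges labeled by cubes in $W$ (the cube $\mathrm{Ba}$ itself labels no edge). A solution for target $\mathrm{Ba}$ is a bijection $\sigma$ from $W$ to the corner numbers of $\mathrm{Ba}$ with $\sigma(C)$ a corner number of $C$ for all $C\in W$; the solution number is the number of such bijections. An isolated vertex counts as a tree with $0$ edges. -}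

module Defs where

open import Data.Nat using (ℕ; _+_; _*_; _⊓_; _≟_; _≤_)
open import Data.Fin using (Fin)
open import Data.Fin.Properties using () renaming (_≟_ to _≟ᶠ_)
open import Data.Vec using (Vec; []; _∷_; lookup; toList)
open import Data.Vec.Membership.Propositional using (_∈_)
open import Data.Vec.Membership.DecPropositional _≟_ using (_∈?_)
open import Data.List as List using (List; filter; length; allFin)
open import Data.List.Relation.Unary.Unique.Propositional using (Unique)
open import Data.List.Relation.Binary.Permutation.Propositional using (_↭_)
import Data.List.Membership.Propositional as LM
open import Data.Product using (Σ; ∃; _×_; _,_)
open import Data.Sum using (_⊎_)
open import Data.Unit using (⊤)
open import Relation.Nullary using (¬_)
open import Relation.Binary.PropositionalEquality using (_≡_; _≢_; refl)
open import Relation.Binary.Construct.Closure.ReflexiveTransitive using (Star)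

-- A colouring is a vector of the colours (natural numbers 1..6) of the
-- faces, in the fixed order  Up, Down, Front, Right, Back, Left.
-- Coordinates: Right = +x, Back = +y, Up = +z (right-handed), so
-- Left = -x, Front = -y, Down = -z.

Colouring : Set
Colouring = Vec ℕ 6

IsMacMahon : Colouring → Set
IsMacMahon v = toList v ↭ (1 List.∷ 2 List.∷ 3 List.∷ 4 List.∷ 5 List.∷ 6 List.∷ List.[])

-- Two quarter turns about perpendicular axes; they generate the
-- rotation group of the cube.
-- rotU: about the Up–Down axis, Front → Right → Back → Left → Front.
rotU : Colouring → Colouring
rotU (u ∷ d ∷ f ∷ r ∷ b ∷ l ∷ []) = u ∷ d ∷ l ∷ f ∷ r ∷ b ∷ []

-- rotF: about the Front–Back axis, Up → Right → Down → Left → Up.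
rotF : Colouring → Colouring
rotF (u ∷ d ∷ f ∷ r ∷ b ∷ l ∷ []) = l ∷ r ∷ f ∷ u ∷ b ∷ d ∷ []

RotStep : Colouring → Colouring → Set
RotStep c d = (d ≡ rotU c) ⊎ (d ≡ rotF c)

SameCube : Colouring → Colouring → Set
SameCube = Star RotStep

val : ℕ → ℕ → ℕ → ℕ
val a b c = 100 * a + 10 * b + c

-- colours a, b, c read clockwise from outside; corner number is the
-- cyclic rotation with smallest three-digit value
cornerNum : ℕ → ℕ → ℕ → ℕ
cornerNum a b c = (val a b c ⊓ val b c a) ⊓ val c a b

-- The eight vertices, with their three faces listed clockwise as seen
-- from outside (determined by the right-handed coordinates above).
corners : Colouring → Vec ℕ 8
corners (u ∷ d ∷ f ∷ r ∷ b ∷ l ∷ []) =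
  cornerNum r u b ∷
  cornerNum r f u ∷
  cornerNum l u f ∷
  cornerNum l b u ∷
  cornerNum r b d ∷
  cornerNum r d f ∷
  cornerNum l f d ∷
  cornerNum l d b ∷
  []

-- The cube Ba and its corner numbers (= vertices of M, indexed by Fin 8).

BaCorners : Vec ℕ 8
BaCorners = 123 ∷ 134 ∷ 146 ∷ 162 ∷ 253 ∷ 265 ∷ 354 ∷ 456 ∷ []

-- the cube with these corner numbers (sanity check: it exists)
baColouring : Colouring
baColouring = 1 ∷ 5 ∷ 4 ∷ 3 ∷ 2 ∷ 6 ∷ []

baColouring-corners :
  corners baColouring ≡ 123 ∷ 134 ∷ 146 ∷ 162 ∷ 253 ∷ 354 ∷ 456 ∷ 265 ∷ []
baColouring-corners = refl

IsBa : Colouring → Set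
IsBa c = ∀ n → (n ∈ corners c → n ∈ BaCorners) × (n ∈ BaCorners → n ∈ corners c)

-- A set W of eight distinct MacMahon cubes, given by representatives.

Cubes8 : Set
Cubes8 = Vec Colouring 8

shared : Cubes8 → Fin 8 → List (Fin 8)
shared W i = filter (λ j → lookup BaCorners j ∈? corners (lookup W i)) (allFin 8)

-- cube i of W labels an edge of G_W joining vertices u and v
-- (it shares exactly the two corner numbers u, v with Ba)
Edge : Cubes8 → Fin 8 → Fin 8 → Fin 8 → Set
Edge W i u v = shared W i ≡ u List.∷ v List.∷ List.[]

IsEdge : Cubes8 → Fin 8 → Set
IsEdge W i = length (shared W i) ≡ 2

numEdges : Cubes8 → ℕ
numEdges W = length (filter (λ i → length (shared W i) ≟ 2) (allFin 8))

AdjExcept : Cubes8 → (Fin 8 → Set) → Fin 8 → Fin 8 → Set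
AdjExcept W allowed u v = ∃ λ i → allowed i × (Edge W i u v ⊎ Edge W i v u)

Adj : Cubes8 → Fin 8 → Fin 8 → Set
Adj W = AdjExcept W (λ _ → ⊤)

Connected : Cubes8 → Fin 8 → Fin 8 → Set
Connected W = Star (Adj W)

TwoComponents : Cubes8 → Set
TwoComponents W = Σ (Fin 8) λ u → Σ (Fin 8) λ v →
  ¬ Connected W u v × (∀ x → Connected W u x ⊎ Connected W v x)

EdgeIn : Cubes8 → Fin 8 → Fin 8 → Set
EdgeIn W r i = ∃ λ u → ∃ λ v → Edge W i u v × Connected W r u

-- the component of r is a tree (connected by construction, and acyclic:
-- no edge of it lies on a cycle, i.e. removing it disconnects its ends)
-- and has exactly k edges
ComponentIsTreeWithEdges : Cubes8 → Fin 8 → ℕ → Set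
ComponentIsTreeWithEdges W r k =
  (∀ i u v → Edge W i u v → Connected W r u →
     ¬ Star (AdjExcept W (λ j → j ≢ i)) u v)
  × (Σ (List (Fin 8)) λ L → Unique L × length L ≡ k
       × (∀ i → (i LM.∈ L → EdgeIn W r i) × (EdgeIn W r i → i LM.∈ L)))

-- Solutions: a bijection σ from W to the corner numbers of Ba
-- (σ sends cube i to corner number lookup BaCorners (lookup σ i)),
-- with σ(C) a corner number of C.

IsSolution : Cubes8 → Vec (Fin 8) 8 → Set
IsSolution W σ =
  (∀ i j → lookup σ i ≡ lookup σ j → i ≡ j)
  × (∀ y → ∃ λ i → lookup σ i ≡ y)
  × (∀ i → lookup BaCorners (lookup σ i) ∈ corners (lookup W i))

SolutionNumber≡ : Cubes8 → ℕ → Set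
SolutionNumber≡ W n = Σ (List (Vec (Fin 8) 8)) λ L → Unique L × length L ≡ n
  × (∀ σ → (σ LM.∈ L → IsSolution W σ) × (IsSolution W σ → σ LM.∈ L))

-- Every cube other than Ba shares exactly two corner numbers with Ba, i.e. labels an edge of G_W,
-- so a solution is a corner x for Ba together with an injective choice of an end for every edge
-- (an orientation) that avoids x. A connected component with c vertices has at least c − 1 edges;
-- as G_W has 8 vertices, 7 edges and two components, one component is a tree with k edges and
-- the other has as many edges as vertices. Pigeonhole puts x in the tree, the orientation of a
-- tree avoiding one of its vertices is unique, and a component with as many edges as vertices has
-- exactly two orientations (one for each direction around its cycle): 2(k + 1) solutions. The
-- three facts about components are proved by induction on the edge list, according to whether
-- the new edge lies outside the component, closes a cycle in it, or is a bridge.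
module Submission where

import Data.Nat
open import Data.Nat using (ℕ; suc; _≤_; _*_; _+_; z≤n; s≤s; s≤s⁻¹)
open import Data.Nat.Properties
  using ( +-comm; +-suc; *-comm; n≤1+n; 1+n≰n; <⇒≢; m≤n⇒m<n∨m≡n; +-cancelˡ-≡; +-mono-<-≤
        ; suc-injective; ≤-trans; +-mono-≤; +-monoʳ-≤; m+n≤o⇒m≤o∸n; module ≤-Reasoning)
open import Data.Bool using (Bool; true; false)
open import Data.Empty using (⊥-elim)
open import Data.Fin using (Fin; punchOut)
import Data.Fin as Fin
open import Data.Fin.Properties using (any?; punchOut-injective; injective⇒≤)
open import Data.Product using (Σ; ∃; _×_; _,_; proj₁; proj₂)
import Data.Product
open import Data.Sum using (_⊎_; inj₁; inj₂; [_,_])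
import Data.Sum as Sum
open import Data.List using (List; []; _∷_; _++_; length; map; filter; allFin; cartesianProductWith)
open import Data.List.Properties
  using (length-tabulate; length-++; length-map; filter-all; filter-≐; filter-accept; filter-reject)
open import Data.List.Relation.Unary.All as All using (All; []; _∷_)
import Data.List.Relation.Unary.All.Properties as All
open import Data.List.Relation.Unary.Any using (here; there)
open import Data.List.Membership.Propositional using (_∈_; _∉_)
open import Data.List.Membership.DecPropositional (Fin._≟_ {8}) using (_∈?_)
open import Data.List.Membership.Propositional.Properties
  using (∈-filter⁺; ∈-filter⁻; ∈-allFin; ∈-map⁻; ∈-++⁻; ∈-cartesianProductWith⁺; ∈-cartesianProductWith⁻)
open import Data.List.Relation.Unary.Unique.Propositional using (Unique; []; _∷_)
open import Data.List.Relation.Unary.Unique.Propositional.Properties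
  using (filter⁺; allFin⁺; ++⁺; cartesianProductWith⁺)
open import Data.Vec using (Vec; lookup; tabulate)
open import Data.Vec.Properties using (lookup∘tabulate; tabulate∘lookup; tabulate-cong)
open import Data.Vec.Membership.Propositional using () renaming (_∈_ to _∈ᵛ_)
open import Data.Vec.Membership.Propositional.Properties using (∈-lookup)
open import Data.Vec.Membership.DecPropositional Data.Nat._≟_ using () renaming (_∈?_ to _∈ᵛ?_)
open import Function using (_∘_; id)
open import Level using (0ℓ)
open import Relation.Nullary using (¬_; Dec; yes; no; ¬?)
open import Relation.Nullary.Decidable using (map′; _×-dec_; _⊎-dec_)
import Relation.Unary
open import Relation.Unary using (Pred; Decidable; _⊆_; _≐_; _∪_; _⊥_; ∁)
open import Relation.Unary.Properties using (≐-sym)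
open import Relation.Binary.Definitions using (DecidableEquality)
open import Relation.Binary.Construct.Closure.ReflexiveTransitive as Star using (Star; ε; _◅_; _◅◅_)
open import Relation.Binary.PropositionalEquality
  using (_≡_; _≢_; refl; sym; trans; cong; cong₂; subst; module ≡-Reasoning)

open import Defs hiding (Adj; Connected; Edge; EdgeIn)

-- Counting

+-tight : ∀ {m n o p} → m ≤ o → n ≤ p → m + n ≡ o + p → m ≡ o × n ≡ p
+-tight {m} m≤o n≤p m+n≡o+p with m≤n⇒m<n∨m≡n m≤o
... | inj₁ m<o  = ⊥-elim (<⇒≢ (+-mono-<-≤ m<o n≤p) m+n≡o+p)
... | inj₂ refl = refl , +-cancelˡ-≡ m _ _ m+n≡o+p

+-tight-suc : ∀ {m n o p} → m ≤ suc o → n ≤ suc p → m + n ≡ suc (o + p) →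
  (m ≡ suc o × n ≡ p) ⊎ (m ≡ o × n ≡ suc p)
+-tight-suc {o = o} m≤1+o n≤1+p m+n≡1+o+p with m≤n⇒m<n∨m≡n m≤1+o
... | inj₁ (s≤s m≤o) = inj₂ (+-tight m≤o n≤1+p (trans m+n≡1+o+p (sym (+-suc o _))))
... | inj₂ refl      = inj₁ (refl , +-cancelˡ-≡ o _ _ (suc-injective m+n≡1+o+p))

module _ {A : Set} {P Q R : Pred A 0ℓ} (P? : Decidable P) (Q? : Decidable Q) (R? : Decidable R) where

  length-filter-⊎ : R ≐ P ∪ Q → P ⊥ Q → ∀ xs →
    length (filter R? xs) ≡ length (filter P? xs) + length (filter Q? xs)
  length-filter-⊎ _ _ [] = refl
  length-filter-⊎ R≐P∪Q P⊥Q (x ∷ xs) with R? x | P? x | Q? x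
  ... | _     | yes p | yes q = ⊥-elim (P⊥Q (p , q))
  ... | no ¬r | yes p | _     = ⊥-elim (¬r (proj₂ R≐P∪Q (inj₁ p)))
  ... | no ¬r | _     | yes q = ⊥-elim (¬r (proj₂ R≐P∪Q (inj₂ q)))
  ... | yes r | no ¬p | no ¬q = ⊥-elim ([ ¬p , ¬q ] (proj₁ R≐P∪Q r))
  ... | no _  | no _  | no _  = length-filter-⊎ R≐P∪Q P⊥Q xs
  ... | yes _ | yes _ | no _  = cong suc (length-filter-⊎ R≐P∪Q P⊥Q xs)
  ... | yes _ | no _  | yes _ = trans (cong suc (length-filter-⊎ R≐P∪Q P⊥Q xs)) (sym (+-suc _ _))

module Removal {A : Set} (_≟_ : DecidableEquality A) where

  _without_ : List A → A → List A
  xs without y = filter (λ x → ¬? (x ≟ y)) xs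

  without-∈ : ∀ {xs x y} → x ∈ xs → x ≢ y → x ∈ xs without y
  without-∈ = ∈-filter⁺ (λ x → ¬? (x ≟ _))

  without-unique : ∀ {xs} y → Unique xs → Unique (xs without y)
  without-unique y = filter⁺ (λ x → ¬? (x ≟ y))

  module _ {P : Pred A 0ℓ} (P? : Decidable P) where

    length-filter-without : ∀ {xs y} → Unique xs → y ∈ xs → P y →
      length (filter P? xs) ≡ suc (length (filter P? (xs without y)))
    length-filter-without {x ∷ xs} (x∉xs ∷ _) (here refl) Px with P? x | x ≟ x
    ... | no ¬Px | _      = ⊥-elim (¬Px Px)
    ... | _      | no x≢x = ⊥-elim (x≢x refl)
    ... | yes _  | yes _  = cong (λ ys → suc (length (filter P? ys)))
      (sym (filter-all (λ x → ¬? (x ≟ _)) (All.map (λ x≢y y≡x → x≢y (sym y≡x)) x∉xs)))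
    length-filter-without {x ∷ xs} {y} (x∉xs ∷ !xs) (there y∈xs) Py with x ≟ y
    ... | yes refl = ⊥-elim (All.lookup x∉xs y∈xs refl)
    ... | no _ with P? x
    ...   | yes _ = cong suc (length-filter-without !xs y∈xs Py)
    ...   | no _  = length-filter-without !xs y∈xs Py

    length≤length-filter : ∀ {zs xs} → Unique zs → Unique xs →
      (∀ {z} → z ∈ zs → z ∈ xs × P z) → length zs ≤ length (filter P? xs)
    length≤length-filter {[]} _ _ _ = z≤n
    length≤length-filter {z ∷ zs} {xs} (z∉zs ∷ !zs) !xs zs⊆P =
      subst (suc (length zs) ≤_) (sym (length-filter-without !xs z∈xs Pz))
        (s≤s (length≤length-filter !zs (without-unique z !xs) zs⊆P-z))
      where
      z∈xs = proj₁ (zs⊆P (here refl))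
      Pz = proj₂ (zs⊆P (here refl))
      zs⊆P-z : ∀ {z′} → z′ ∈ zs → z′ ∈ xs without z × P z′
      zs⊆P-z z′∈zs =
        without-∈ (proj₁ (zs⊆P (there z′∈zs))) (λ z′≡z → All.lookup z∉zs z′∈zs (sym z′≡z)) ,
        proj₂ (zs⊆P (there z′∈zs))

map-unique : ∀ {A B : Set} {f : A → B} {xs} → (∀ {x y} → x ∈ xs → y ∈ xs → f x ≡ f y → x ≡ y) →
  Unique xs → Unique (map f xs)
map-unique {xs = []} _ [] = []
map-unique {xs = x ∷ xs} f-inj (x∉xs ∷ !xs) =
  All.map⁺ (All.tabulate λ y∈xs fx≡fy → All.lookup x∉xs y∈xs (f-inj (here refl) (there y∈xs) fx≡fy)) ∷
  map-unique (λ x∈ y∈ → f-inj (there x∈) (there y∈)) !xs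

length-cartesianProductWith : ∀ {A B C : Set} (f : A → B → C) xs ys →
  length (cartesianProductWith f xs ys) ≡ length xs * length ys
length-cartesianProductWith f [] ys = refl
length-cartesianProductWith f (x ∷ xs) ys =
  trans (length-++ (map (f x) ys)) (cong₂ _+_ (length-map (f x) ys) (length-cartesianProductWith f xs ys))

injective⇒surjective : ∀ {m} (f : Fin (suc m) → Fin (suc m)) → (∀ i j → f i ≡ f j → i ≡ j) →
  ∀ y → ∃ λ i → f i ≡ y
injective⇒surjective {m} f f-injective y with any? (λ i → f i Fin.≟ y)
... | yes hit = hit
... | no miss = ⊥-elim (1+n≰n (injective⇒≤ missing-y-injective))
  where
  y≢f : ∀ i → y ≢ f i
  y≢f i y≡fi = miss (i , sym y≡fi)
  missing-y : Fin (suc m) → Fin m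
  missing-y i = punchOut (y≢f i)
  missing-y-injective : ∀ {i j} → missing-y i ≡ missing-y j → i ≡ j
  missing-y-injective {i} {j} eq = f-injective i j (punchOut-injective (y≢f i) (y≢f j) eq)

∣_∣ : ∀ {n} {P : Pred (Fin n) 0ℓ} → Decidable P → ℕ
∣_∣ {n} P? = length (filter P? (allFin n))

module _ {n : ℕ} {P Q : Pred (Fin n) 0ℓ} (P? : Decidable P) (Q? : Decidable Q) where

  ∣∣-cong : P ≐ Q → ∣ P? ∣ ≡ ∣ Q? ∣
  ∣∣-cong P≐Q = cong length (filter-≐ P? Q? P≐Q (allFin n))

  ∣∣-∪ : ∀ {R : Pred (Fin n) 0ℓ} (R? : Decidable R) → R ≐ P ∪ Q → P ⊥ Q →
    ∣ R? ∣ ≡ ∣ P? ∣ + ∣ Q? ∣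
  ∣∣-∪ R? R≐P∪Q P⊥Q = length-filter-⊎ P? Q? R? R≐P∪Q P⊥Q (allFin n)

module _ {n : ℕ} {P : Pred (Fin n) 0ℓ} (P? : Decidable P) where

  length≤∣∣ : ∀ {zs} → Unique zs → (∀ {z} → z ∈ zs → P z) → length zs ≤ ∣ P? ∣
  length≤∣∣ !zs zs⊆P =
    Removal.length≤length-filter Fin._≟_ P? !zs (allFin⁺ n) λ z∈zs → ∈-allFin _ , zs⊆P z∈zs

  ∣∣≤1 : (∀ {x y} → P x → P y → x ≡ y) → ∣ P? ∣ ≤ 1
  ∣∣≤1 P-subsingleton = length≤1 (filter⁺ P? (allFin⁺ n)) (λ x∈ → proj₂ (∈-filter⁻ P? {xs = allFin n} x∈))
    where
    length≤1 : ∀ {xs} → Unique xs → (∀ {x} → x ∈ xs → P x) → length xs ≤ 1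
    length≤1 {[]} _ _ = z≤n
    length≤1 {_ ∷ []} _ _ = s≤s z≤n
    length≤1 {_ ∷ _ ∷ _} ((x≢y ∷ _) ∷ _) xs⊆P =
      ⊥-elim (x≢y (P-subsingleton (xs⊆P (here refl)) (xs⊆P (there (here refl)))))

-- Multigraphs and their components

module Multigraph {n : ℕ} {E : Set} (_≟ᴱ_ : DecidableEquality E) (src tgt : E → Fin n) where

  open Removal _≟ᴱ_ using (_without_; without-∈; length-filter-without)

  Joins : E → Fin n → Fin n → Set
  Joins e u v = (u ≡ src e × v ≡ tgt e) ⊎ (u ≡ tgt e × v ≡ src e)

  joins-sym : ∀ {e u v} → Joins e u v → Joins e v u
  joins-sym (inj₁ (u≡s , v≡t)) = inj₂ (v≡t , u≡s)
  joins-sym (inj₂ (u≡t , v≡s)) = inj₁ (v≡s , u≡t)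

  Adjacent : List E → Fin n → Fin n → Set
  Adjacent es u v = ∃ λ e → e ∈ es × Joins e u v

  Connected : List E → Fin n → Fin n → Set
  Connected es = Star (Adjacent es)

  Loopless : List E → Set
  Loopless es = ∀ {e} → e ∈ es → src e ≢ tgt e

  connected-sym : ∀ {es u v} → Connected es u v → Connected es v u
  connected-sym = Star.reverse λ (e , e∈es , joins) → e , e∈es , joins-sym joins

  connected-edge : ∀ {es e u v} → e ∈ es → Joins e u v → Connected es u v
  connected-edge e∈es joins = (_ , e∈es , joins) ◅ ε

  connected-mono : ∀ {es es′ u v} → (∀ {e} → e ∈ es → e ∈ es′) → Connected es u v → Connected es′ u v
  connected-mono es⊆es′ = Star.map λ (e , e∈es , joins) → e , es⊆es′ e∈es , joins

  connected-∷ : ∀ {i es u v} → Connected es u v → Connected (i ∷ es) u v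
  connected-∷ = connected-mono there

  connected-[] : ∀ {u v} → Connected [] u v → u ≡ v
  connected-[] ε = refl

  -- A path may be assumed to use a new edge at most once.
  connected-∷⁻ : ∀ {i es x y} → Connected (i ∷ es) x y →
    Connected es x y ⊎ ∃ λ u → ∃ λ v → Joins i u v × Connected es x u × Connected es v y
  connected-∷⁻ ε = inj₁ ε
  connected-∷⁻ ((e , there e∈es , joins) ◅ path) with connected-∷⁻ path
  ... | inj₁ direct = inj₁ ((e , e∈es , joins) ◅ direct)
  ... | inj₂ (u , v , uv , xu , vy) = inj₂ (u , v , uv , (e , e∈es , joins) ◅ xu , vy)
  connected-∷⁻ ((_ , here refl , joins) ◅ path) with connected-∷⁻ path | joins
  ... | inj₁ direct                                | _                  = inj₂ (_ , _ , joins , ε , direct)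
  ... | inj₂ (_ , _ , inj₁ (refl , refl) , _ , vy) | inj₁ (refl , refl) = inj₂ (_ , _ , joins , ε , vy)
  ... | inj₂ (_ , _ , inj₂ (refl , refl) , _ , vy) | inj₂ (refl , refl) = inj₂ (_ , _ , joins , ε , vy)
  ... | inj₂ (_ , _ , inj₁ (refl , refl) , _ , vy) | inj₂ (refl , refl) = inj₁ vy
  ... | inj₂ (_ , _ , inj₂ (refl , refl) , _ , vy) | inj₁ (refl , refl) = inj₁ vy

  connected? : ∀ es x y → Dec (Connected es x y)
  connected? [] x y = map′ (λ { refl → ε }) connected-[] (x Fin.≟ y)
  connected? (i ∷ es) x y = map′ from to
    (connected? es x y ⊎-dec ((connected? es x (src i) ×-dec connected? es (tgt i) y)
                          ⊎-dec (connected? es x (tgt i) ×-dec connected? es (src i) y)))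
    where
    via : ∀ {u v} → Joins i u v → Connected es x u → Connected es v y → Connected (i ∷ es) x y
    via uv xu vy = connected-∷ xu ◅◅ connected-edge (here refl) uv ◅◅ connected-∷ vy
    from = [ connected-∷ , [ (λ (xs , ty) → via (inj₁ (refl , refl)) xs ty)
                           , (λ (xt , sy) → via (inj₂ (refl , refl)) xt sy) ] ]
    to : Connected (i ∷ es) x y → _
    to path with connected-∷⁻ path
    ... | inj₁ direct = inj₁ direct
    ... | inj₂ (_ , _ , inj₁ (refl , refl) , xu , vy) = inj₂ (inj₁ (xu , vy))
    ... | inj₂ (_ , _ , inj₂ (refl , refl) , xu , vy) = inj₂ (inj₂ (xu , vy))

  connected-∷-src : ∀ {i es u v} → Joins i u v → Connected (i ∷ es) u (src i)
  connected-∷-src (inj₁ (refl , _)) = ε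
  connected-∷-src (inj₂ (refl , refl)) = connected-edge (here refl) (inj₂ (refl , refl))

  connected-∷-outside : ∀ {i es w y} → ¬ Connected (i ∷ es) w (src i) →
    Connected (i ∷ es) w y → Connected es w y
  connected-∷-outside w≁i path with connected-∷⁻ path
  ... | inj₁ direct = direct
  ... | inj₂ (_ , _ , uv , wu , _) = ⊥-elim (w≁i (connected-∷ wu ◅◅ connected-∷-src uv))

  connected-∷-cycle : ∀ {i es x y} → Connected es (src i) (tgt i) →
    Connected (i ∷ es) x y → Connected es x y
  connected-∷-cycle {i} {es} s∼t path with connected-∷⁻ path
  ... | inj₁ direct = direct
  ... | inj₂ (_ , _ , uv , xu , vy) = xu ◅◅ joined uv ◅◅ vy
    where
    joined : ∀ {u v} → Joins i u v → Connected es u v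
    joined (inj₁ (refl , refl)) = s∼t
    joined (inj₂ (refl , refl)) = connected-sym s∼t

  connected-∷-bridge : ∀ {i es u v y} → Joins i u v →
    Connected (i ∷ es) u y → Connected es u y ⊎ Connected es v y
  connected-∷-bridge uv path with connected-∷⁻ path
  ... | inj₁ direct = inj₁ direct
  ... | inj₂ (_ , _ , u′v′ , _ , v′y) with uv | u′v′
  ...   | inj₁ (refl , refl) | inj₁ (refl , refl) = inj₂ v′y
  ...   | inj₂ (refl , refl) | inj₂ (refl , refl) = inj₂ v′y
  ...   | inj₁ (refl , refl) | inj₂ (refl , refl) = inj₁ v′y
  ...   | inj₂ (refl , refl) | inj₁ (refl , refl) = inj₁ v′y

  connected-without : ∀ {es e x y} → Connected (es without e) (src e) (tgt e) →
    Connected es x y → Connected (es without e) x y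
  connected-without {es} {e} s∼t = Star.fold (Connected (es without e)) (λ step path → reroute step ◅◅ path) ε
    where
    reroute : ∀ {x y} → Adjacent es x y → Connected (es without e) x y
    reroute (e′ , e′∈es , joins) with e′ ≟ᴱ e | joins
    ... | no e′≢e  | _                  = connected-edge (without-∈ e′∈es e′≢e) joins
    ... | yes refl | inj₁ (refl , refl) = s∼t
    ... | yes refl | inj₂ (refl , refl) = connected-sym s∼t

  component-∷-outside : ∀ {i es w} → ¬ Connected (i ∷ es) w (src i) →
    Connected (i ∷ es) w ≐ Connected es w
  component-∷-outside w≁i = connected-∷-outside w≁i , connected-∷

  component-∷-cycle : ∀ {i es w} → Connected es (src i) (tgt i) →
    Connected (i ∷ es) w ≐ Connected es w
  component-∷-cycle s∼t = connected-∷-cycle s∼t , connected-∷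

  component-∷-bridge : ∀ {i es w u v} → Joins i u v → Connected (i ∷ es) w u →
    Connected (i ∷ es) w ≐ Connected es u ∪ Connected es v
  component-∷-bridge uv wu =
    (λ wy → connected-∷-bridge uv (connected-sym wu ◅◅ wy)) ,
    [ (λ uy → wu ◅◅ connected-∷ uy) , (λ vy → wu ◅◅ connected-edge (here refl) uv ◅◅ connected-∷ vy) ]

  components-disjoint : ∀ {es u v} → ¬ Connected es u v → Connected es u ⊥ Connected es v
  components-disjoint u≁v (uy , vy) = u≁v (uy ◅◅ connected-sym vy)

  #within : ∀ {P : Pred (Fin n) 0ℓ} → Decidable P → List E → ℕ
  #within P? es = length (filter (λ e → P? (src e)) es)

  #within-cong : ∀ {P Q : Pred (Fin n) 0ℓ} (P? : Decidable P) (Q? : Decidable Q) →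
    P ≐ Q → ∀ es → #within P? es ≡ #within Q? es
  #within-cong P? Q? (P⊆Q , Q⊆P) = cong length ∘ filter-≐ (λ e → P? (src e)) (λ e → Q? (src e)) (P⊆Q , Q⊆P)

  #within-∪ : ∀ {P Q R : Pred (Fin n) 0ℓ} (P? : Decidable P) (Q? : Decidable Q) (R? : Decidable R) →
    R ≐ P ∪ Q → P ⊥ Q → ∀ es → #within R? es ≡ #within P? es + #within Q? es
  #within-∪ P? Q? R? (R⊆P∪Q , P∪Q⊆R) P⊥Q =
    length-filter-⊎ (λ e → P? (src e)) (λ e → Q? (src e)) (λ e → R? (src e)) (R⊆P∪Q , P∪Q⊆R) P⊥Q

  EdgeIn : List E → Fin n → Pred E 0ℓ
  EdgeIn es w e = e ∈ es × Connected es w (src e)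

  edges : List E → Fin n → List E
  edges es w = filter (λ e → connected? es w (src e)) es

  -- Among connected graphs, trees have one vertex more than edges and unicyclic graphs as many.
  IsTree IsUnicyclic : List E → Fin n → Set
  IsTree es w      = ∣ connected? es w ∣ ≡ suc (length (edges es w))
  IsUnicyclic es w = ∣ connected? es w ∣ ≡ length (edges es w)

  #edges-∷-outside : ∀ {i es w} → ¬ Connected (i ∷ es) w (src i) →
    length (edges (i ∷ es) w) ≡ length (edges es w)
  #edges-∷-outside {i} {es} {w} w≁i =
    trans (cong length (filter-reject (λ e → connected? (i ∷ es) w (src e)) w≁i))
          (#within-cong (connected? (i ∷ es) w) (connected? es w) (component-∷-outside w≁i) es)

  #edges-∷-inside : ∀ {i es w} → Connected (i ∷ es) w (src i) →
    length (edges (i ∷ es) w) ≡ suc (#within (connected? (i ∷ es) w) es)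
  #edges-∷-inside {i} {es} {w} w∼i = cong length (filter-accept (λ e → connected? (i ∷ es) w (src e)) w∼i)

  #edges-∷-cycle : ∀ {i es w} → Connected (i ∷ es) w (src i) → Connected es (src i) (tgt i) →
    length (edges (i ∷ es) w) ≡ suc (length (edges es w))
  #edges-∷-cycle {i} {es} {w} w∼i s∼t = trans (#edges-∷-inside w∼i)
    (cong suc (#within-cong (connected? (i ∷ es) w) (connected? es w) (component-∷-cycle s∼t) es))

  ∣component∣≤1+#edges : ∀ es w → ∣ connected? es w ∣ ≤ suc (length (edges es w))
  ∣component∣≤1+#edges [] w =
    ≤-trans (∣∣≤1 (connected? [] w) λ wx wy → trans (sym (connected-[] wx)) (connected-[] wy)) (s≤s z≤n)
  ∣component∣≤1+#edges (i ∷ es) w with connected? (i ∷ es) w (src i) | connected? es (src i) (tgt i)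
  ... | no w≁i | _ = begin
    ∣ connected? (i ∷ es) w ∣         ≡⟨ ∣∣-cong _ _ (component-∷-outside w≁i) ⟩
    ∣ connected? es w ∣               ≤⟨ ∣component∣≤1+#edges es w ⟩
    suc (length (edges es w))         ≡⟨ cong suc (#edges-∷-outside w≁i) ⟨
    suc (length (edges (i ∷ es) w))   ∎
    where open ≤-Reasoning
  ... | yes w∼i | yes s∼t = begin
    ∣ connected? (i ∷ es) w ∣         ≡⟨ ∣∣-cong _ _ (component-∷-cycle s∼t) ⟩
    ∣ connected? es w ∣               ≤⟨ ∣component∣≤1+#edges es w ⟩
    suc (length (edges es w))         ≤⟨ n≤1+n _ ⟩
    suc (suc (length (edges es w)))   ≡⟨ cong suc (#edges-∷-cycle w∼i s∼t) ⟨
    suc (length (edges (i ∷ es) w))   ∎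
    where open ≤-Reasoning
  ... | yes w∼i | no s≁t = begin
    ∣ connected? (i ∷ es) w ∣
      ≡⟨ ∣∣-∪ (connected? es (src i)) (connected? es (tgt i)) (connected? (i ∷ es) w) split disjoint ⟩
    ∣ connected? es (src i) ∣ + ∣ connected? es (tgt i) ∣
      ≤⟨ +-mono-≤ (∣component∣≤1+#edges es (src i)) (∣component∣≤1+#edges es (tgt i)) ⟩
    suc (length (edges es (src i))) + suc (length (edges es (tgt i)))
      ≡⟨ cong suc (+-suc _ _) ⟩
    suc (suc (length (edges es (src i)) + length (edges es (tgt i))))
      ≡⟨ cong (suc ∘ suc) (#within-∪ (connected? es (src i)) (connected? es (tgt i)) (connected? (i ∷ es) w)
                                      split disjoint es) ⟨
    suc (suc (#within (connected? (i ∷ es) w) es))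
      ≡⟨ cong suc (#edges-∷-inside w∼i) ⟨
    suc (length (edges (i ∷ es) w))   ∎
    where
    open ≤-Reasoning
    split = component-∷-bridge (inj₁ (refl , refl)) w∼i
    disjoint = components-disjoint s≁t

  -- Removing an edge of a tree would leave a connected graph with too few edges.
  tree-edge-bridge : ∀ {es w e} → Unique es → IsTree es w → EdgeIn es w e → ¬ Connected (es without e) (src e) (tgt e)
  tree-edge-bridge {es} {w} {e} !es tree (e∈es , w∼e) s∼t = 1+n≰n (begin
    suc (suc (#within (connected? es w) (es without e)))
      ≡⟨ cong suc (length-filter-without (λ e → connected? es w (src e)) !es e∈es w∼e) ⟨
    suc (length (edges es w))               ≡⟨ tree ⟨
    ∣ connected? es w ∣                     ≡⟨ ∣∣-cong _ _ same-component ⟩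
    ∣ connected? (es without e) w ∣         ≤⟨ ∣component∣≤1+#edges (es without e) w ⟩
    suc (length (edges (es without e) w))
      ≡⟨ cong suc (#within-cong (connected? (es without e) w) (connected? es w) (≐-sym same-component) (es without e)) ⟩
    suc (#within (connected? es w) (es without e)) ∎)
    where
    open ≤-Reasoning
    same-component : Connected es w ≐ Connected (es without e) w
    same-component = connected-without s∼t , connected-mono (λ e′∈ → proj₁ (∈-filter⁻ (λ x → ¬? (x ≟ᴱ e)) e′∈))

  unicyclic-size : ∀ {es c} → Loopless es → IsUnicyclic es c → 2 ≤ ∣ connected? es c ∣
  unicyclic-size {es} {c} loopless unicyclic with edges es c in edges≡
  ... | [] = ⊥-elim (1+n≰n (subst (1 ≤_) unicyclic (length≤∣∣ (connected? es c) ([] ∷ []) λ { (here refl) → ε })))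
  ... | e ∷ _ = length≤∣∣ (connected? es c) (((loopless e∈es) ∷ []) ∷ [] ∷ [])
      λ { (here refl) → c∼e ; (there (here refl)) → c∼e ◅◅ connected-edge e∈es (inj₁ (refl , refl)) }
    where
    e∈edges : e ∈ edges es c
    e∈edges = subst (e ∈_) (sym edges≡) (here refl)
    e∈es = proj₁ (∈-filter⁻ (λ e → connected? es c (src e)) {xs = es} e∈edges)
    c∼e = proj₂ (∈-filter⁻ (λ e → connected? es c (src e)) {xs = es} e∈edges)

  record Orientation (D : Pred E 0ℓ) (τ : E → Fin n) : Set where
    field
      endpoint  : ∀ {e} → D e → τ e ≡ src e ⊎ τ e ≡ tgt e
      injective : ∀ {e e′} → D e → D e′ → τ e ≡ τ e′ → e ≡ e′

  open Orientation public

  Avoids : Pred E 0ℓ → (E → Fin n) → Fin n → Set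
  Avoids D τ x = ∀ {e} → D e → τ e ≢ x

  Agree : Pred E 0ℓ → (E → Fin n) → (E → Fin n) → Set
  Agree D τ τ′ = ∀ {e} → D e → τ e ≡ τ′ e

  orientation-⊆ : ∀ {D D′ τ} → D′ ⊆ D → Orientation D τ → Orientation D′ τ
  orientation-⊆ D′⊆D o = record
    { endpoint  = endpoint o ∘ D′⊆D
    ; injective = λ d d′ → injective o (D′⊆D d) (D′⊆D d′) }

  orientation-agree : ∀ {D τ τ′} → Agree D τ τ′ → Orientation D τ → Orientation D τ′
  orientation-agree τ≗τ′ o = record
    { endpoint  = λ d → subst (λ y → y ≡ _ ⊎ y ≡ _) (τ≗τ′ d) (endpoint o d)
    ; injective = λ d d′ eq → injective o d d′ (trans (τ≗τ′ d) (trans eq (sym (τ≗τ′ d′)))) }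

  endpoint-joins : ∀ {i u v y} → Joins i u v → y ≡ src i ⊎ y ≡ tgt i → y ≡ u ⊎ y ≡ v
  endpoint-joins (inj₁ (refl , refl)) = id
  endpoint-joins (inj₂ (refl , refl)) = Sum.swap

  orientation-image : ∀ {es w τ e} → Orientation (EdgeIn es w) τ → EdgeIn es w e → Connected es w (τ e)
  orientation-image o (e∈es , w∼e) with endpoint o (e∈es , w∼e)
  ... | inj₁ τe≡s = subst (Connected _ _) (sym τe≡s) w∼e
  ... | inj₂ τe≡t = subst (Connected _ _) (sym τe≡t) (w∼e ◅◅ connected-edge e∈es (inj₁ (refl , refl)))

  -- Pigeonhole: the avoided vertices ys and the images of the edges are distinct vertices of the component.
  orientation-bound : ∀ {es w τ ys} → Unique es → Orientation (EdgeIn es w) τ → Unique ys →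
    (∀ {y} → y ∈ ys → Connected es w y × Avoids (EdgeIn es w) τ y) →
    length ys + length (edges es w) ≤ ∣ connected? es w ∣
  orientation-bound {es} {w} {τ} {ys} !es o !ys ys-avoided =
    subst (_≤ ∣ connected? es w ∣) (trans (length-++ ys) (cong (length ys +_) (length-map τ (edges es w))))
      (length≤∣∣ (connected? es w) (++⁺ !ys (map-unique τ-injective (filter⁺ _ !es)) apart) in-component)
    where
    edge-of : ∀ {e} → e ∈ edges es w → EdgeIn es w e
    edge-of = ∈-filter⁻ (λ e → connected? es w (src e))
    τ-injective : ∀ {e e′} → e ∈ edges es w → e′ ∈ edges es w → τ e ≡ τ e′ → e ≡ e′
    τ-injective e∈ e′∈ = injective o (edge-of e∈) (edge-of e′∈)
    apart : ∀ {y} → ¬ (y ∈ ys × y ∈ map τ (edges es w))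
    apart (y∈ys , y∈image) with ∈-map⁻ τ y∈image
    ... | e , e∈ , y≡τe = proj₂ (ys-avoided y∈ys) (edge-of e∈) (sym y≡τe)
    in-component : ∀ {z} → z ∈ ys ++ map τ (edges es w) → Connected es w z
    in-component z∈ with ∈-++⁻ ys z∈
    ... | inj₁ z∈ys = proj₁ (ys-avoided z∈ys)
    ... | inj₂ z∈image with ∈-map⁻ τ z∈image
    ...   | e , e∈ , refl = orientation-image o (edge-of e∈)

  merge : ∀ {S : Pred E 0ℓ} → Decidable S → (E → Fin n) → (E → Fin n) → E → Fin n
  merge S? τ₁ τ₂ e with S? e
  ... | yes _ = τ₁ e
  ... | no _  = τ₂ e

  module _ {S D₁ D₂ : Pred E 0ℓ} (S? : Decidable S) (D₁⊆S : D₁ ⊆ S) (D₂⊆∁S : D₂ ⊆ ∁ S)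
           {τ₁ τ₂ : E → Fin n} where

    merge-≡₁ : ∀ {e} → D₁ e → merge S? τ₁ τ₂ e ≡ τ₁ e
    merge-≡₁ {e} d with S? e
    ... | yes _ = refl
    ... | no ¬s = ⊥-elim (¬s (D₁⊆S d))

    merge-≡₂ : ∀ {e} → D₂ e → merge S? τ₁ τ₂ e ≡ τ₂ e
    merge-≡₂ {e} d with S? e
    ... | yes s = ⊥-elim (D₂⊆∁S d s)
    ... | no _  = refl

    merge-orientation : Orientation D₁ τ₁ → Orientation D₂ τ₂ → (∀ {e e′} → D₁ e → D₂ e′ → τ₁ e ≢ τ₂ e′) →
      Orientation (D₁ ∪ D₂) (merge S? τ₁ τ₂)
    merge-orientation o₁ o₂ apart = record { endpoint = ends ; injective = inj }
      where
      ends : ∀ {e} → (D₁ ∪ D₂) e → _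
      ends (inj₁ d) = subst (λ y → y ≡ _ ⊎ y ≡ _) (sym (merge-≡₁ d)) (endpoint o₁ d)
      ends (inj₂ d) = subst (λ y → y ≡ _ ⊎ y ≡ _) (sym (merge-≡₂ d)) (endpoint o₂ d)
      inj : ∀ {e e′} → (D₁ ∪ D₂) e → (D₁ ∪ D₂) e′ → merge S? τ₁ τ₂ e ≡ merge S? τ₁ τ₂ e′ → e ≡ e′
      inj (inj₁ d) (inj₁ d′) eq = injective o₁ d d′ (trans (sym (merge-≡₁ d)) (trans eq (merge-≡₁ d′)))
      inj (inj₂ d) (inj₂ d′) eq = injective o₂ d d′ (trans (sym (merge-≡₂ d)) (trans eq (merge-≡₂ d′)))
      inj (inj₁ d) (inj₂ d′) eq = ⊥-elim (apart d d′ (trans (sym (merge-≡₁ d)) (trans eq (merge-≡₂ d′))))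
      inj (inj₂ d) (inj₁ d′) eq =
        ⊥-elim (apart d′ d (trans (sym (merge-≡₁ d′)) (trans (sym eq) (merge-≡₂ d))))

    merge-avoids : ∀ {x} → Avoids D₁ τ₁ x → Avoids D₂ τ₂ x → Avoids (D₁ ∪ D₂) (merge S? τ₁ τ₂) x
    merge-avoids a₁ _ (inj₁ d) = a₁ d ∘ trans (sym (merge-≡₁ d))
    merge-avoids _ a₂ (inj₂ d) = a₂ d ∘ trans (sym (merge-≡₂ d))

    merge-agree : ∀ {τ} → Agree D₁ τ₁ τ → Agree D₂ τ₂ τ → Agree (D₁ ∪ D₂) (merge S? τ₁ τ₂) τ
    merge-agree a₁ _ (inj₁ d) = trans (merge-≡₁ d) (a₁ d)
    merge-agree _ a₂ (inj₂ d) = trans (merge-≡₂ d) (a₂ d)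

  _[_↦_] : (E → Fin n) → E → Fin n → E → Fin n
  τ [ i ↦ y ] = merge (_≟ᴱ i) (λ _ → y) τ

  update-≡ : ∀ τ i y → (τ [ i ↦ y ]) i ≡ y
  update-≡ τ i y = merge-≡₁ {D₂ = ∁ (_≡ i)} (_≟ᴱ i) id id refl

  update-≢ : ∀ τ {i e} y → e ≢ i → (τ [ i ↦ y ]) e ≡ τ e
  update-≢ τ {i} y = merge-≡₂ {D₁ = _≡ i} (_≟ᴱ i) id id

  module _ {i : E} {D : Pred E 0ℓ} (i∉D : D ⊆ ∁ (_≡ i)) where

    orient-toward : ∀ {y τ} → y ≡ src i ⊎ y ≡ tgt i → Orientation D τ → Avoids D τ y →
      Orientation ((_≡ i) ∪ D) (τ [ i ↦ y ])
    orient-toward y-end o avoids-y = merge-orientation (_≟ᴱ i) id i∉D single o λ _ d → avoids-y d ∘ sym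
      where
      single : Orientation (_≡ i) _
      single = record { endpoint = λ { refl → y-end } ; injective = λ { refl refl _ → refl } }

    toward-agree : ∀ {y τ τ′} → Agree D τ τ′ → τ′ i ≡ y → Agree ((_≡ i) ∪ D) (τ [ i ↦ y ]) τ′
    toward-agree agree τ′i≡y = merge-agree (_≟ᴱ i) id i∉D (λ { refl → sym τ′i≡y }) agree

    orientation-drop : ∀ {τ} → Orientation ((_≡ i) ∪ D) τ → Orientation D τ × Avoids D τ (τ i)
    orientation-drop o = orientation-⊆ inj₂ o , λ d τe≡τi → i∉D d (injective o (inj₂ d) (inj₁ refl) τe≡τi)

  record UniqueOrientationAvoiding (D : Pred E 0ℓ) (x : Fin n) (τ : E → Fin n) : Set where
    field
      orientation : Orientation D τ
      avoids-root : Avoids D τ x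
      unique      : ∀ {τ′} → Orientation D τ′ → Avoids D τ′ x → Agree D τ τ′

  uniqueOrientationAvoiding-≐ : ∀ {D D′ x τ} → D ≐ D′ →
    UniqueOrientationAvoiding D x τ → UniqueOrientationAvoiding D′ x τ
  uniqueOrientationAvoiding-≐ (D⊆D′ , D′⊆D) t = record
    { orientation = orientation-⊆ D′⊆D orientation
    ; avoids-root = avoids-root ∘ D′⊆D
    ; unique      = λ o a → unique (orientation-⊆ D⊆D′ o) (a ∘ D⊆D′) ∘ D′⊆D }
    where open UniqueOrientationAvoiding t

  record TwoOrientations (D : Pred E 0ℓ) : Set where
    field
      τ₁ τ₂        : E → Fin n
      orientation₁ : Orientation D τ₁
      orientation₂ : Orientation D τ₂
      distinct     : ∃ λ e → D e × τ₁ e ≢ τ₂ e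
      exhaustive   : ∀ {τ} → Orientation D τ → Agree D τ₁ τ ⊎ Agree D τ₂ τ

  twoOrientations-≐ : ∀ {D D′} → D ≐ D′ → TwoOrientations D → TwoOrientations D′
  twoOrientations-≐ (D⊆D′ , D′⊆D) t = record
    { τ₁           = τ₁
    ; τ₂           = τ₂
    ; orientation₁ = orientation-⊆ D′⊆D orientation₁
    ; orientation₂ = orientation-⊆ D′⊆D orientation₂
    ; distinct     = Data.Product.map₂ (Data.Product.map₁ D⊆D′) distinct
    ; exhaustive   = λ o → Sum.map (λ a d → a (D′⊆D d)) (λ a d → a (D′⊆D d)) (exhaustive (orientation-⊆ D⊆D′ o)) }
    where open TwoOrientations t

  -- The new edge i may point to either end y, and the rest then has to avoid y.
  cycle-orientations : ∀ {i D} → D ⊆ ∁ (_≡ i) → src i ≢ tgt i →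
    (∀ {y} → y ≡ src i ⊎ y ≡ tgt i → ∃ (UniqueOrientationAvoiding D y)) → TwoOrientations ((_≡ i) ∪ D)
  cycle-orientations {i} i∉D s≢t rooted = record
    { τ₁           = toward (inj₁ refl)
    ; τ₂           = toward (inj₂ refl)
    ; orientation₁ = oriented (inj₁ refl)
    ; orientation₂ = oriented (inj₂ refl)
    ; distinct     = i , inj₁ refl , λ eq → s≢t (trans (sym (at-i (inj₁ refl))) (trans eq (at-i (inj₂ refl))))
    ; exhaustive   = exhaustive }
    where
    open UniqueOrientationAvoiding
    toward : ∀ {y} → y ≡ src i ⊎ y ≡ tgt i → E → Fin n
    toward {y} y-end = proj₁ (rooted y-end) [ i ↦ y ]
    oriented : ∀ {y} (y-end : y ≡ src i ⊎ y ≡ tgt i) → Orientation ((_≡ i) ∪ _) (toward y-end)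
    oriented y-end = orient-toward i∉D y-end (orientation (proj₂ (rooted y-end))) (avoids-root (proj₂ (rooted y-end)))
    at-i : ∀ {y} (y-end : y ≡ src i ⊎ y ≡ tgt i) → toward y-end i ≡ y
    at-i {y} y-end = update-≡ (proj₁ (rooted y-end)) i y
    exhaustive : ∀ {τ} → Orientation ((_≡ i) ∪ _) τ →
      Agree _ (toward (inj₁ refl)) τ ⊎ Agree _ (toward (inj₂ refl)) τ
    exhaustive {τ} o with orientation-drop i∉D o | endpoint o (inj₁ refl)
    ... | o-rest , avoids-τi | inj₁ τi≡s = inj₁ (toward-agree i∉D
      (unique (proj₂ (rooted (inj₁ refl))) o-rest λ d → subst (_ ≢_) τi≡s (avoids-τi d)) τi≡s)
    ... | o-rest , avoids-τi | inj₂ τi≡t = inj₂ (toward-agree i∉D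
      (unique (proj₂ (rooted (inj₂ refl))) o-rest λ d → subst (_ ≢_) τi≡t (avoids-τi d)) τi≡t)

  edgeIn-∷-outside : ∀ {i es w} → ¬ Connected (i ∷ es) w (src i) → EdgeIn (i ∷ es) w ≐ EdgeIn es w
  edgeIn-∷-outside w≁i =
    (λ { (here refl , w∼i) → ⊥-elim (w≁i w∼i)
       ; (there e∈es , w∼e) → e∈es , connected-∷-outside w≁i w∼e }) ,
    λ (e∈es , w∼e) → there e∈es , connected-∷ w∼e

  edgeIn-∷-cycle : ∀ {i es w} → Connected (i ∷ es) w (src i) → Connected es (src i) (tgt i) →
    EdgeIn (i ∷ es) w ≐ (_≡ i) ∪ EdgeIn es w
  edgeIn-∷-cycle w∼i s∼t =
    (λ { (here refl , _) → inj₁ refl ; (there e∈es , w∼e) → inj₂ (e∈es , connected-∷-cycle s∼t w∼e) }) ,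
    [ (λ { refl → here refl , w∼i }) , (λ (e∈es , w∼e) → there e∈es , connected-∷ w∼e) ]

  edgeIn-∷-bridge : ∀ {i es w u v} → Joins i u v → Connected (i ∷ es) w u →
    EdgeIn (i ∷ es) w ≐ (_≡ i) ∪ (EdgeIn es u ∪ EdgeIn es v)
  edgeIn-∷-bridge uv w∼u =
    (λ { (here refl , _) → inj₁ refl
       ; (there e∈es , w∼e) → inj₂ (Sum.map (e∈es ,_) (e∈es ,_) (proj₁ (component-∷-bridge uv w∼u) w∼e)) }) ,
    [ (λ { refl → here refl , w∼u ◅◅ connected-∷-src uv })
    , [ (λ (e∈es , u∼e) → there e∈es , proj₂ (component-∷-bridge uv w∼u) (inj₁ u∼e))
      , (λ (e∈es , v∼e) → there e∈es , proj₂ (component-∷-bridge uv w∼u) (inj₂ v∼e)) ] ]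

  module Bridge {i : E} {es : List E} {u v : Fin n} (i∉es : i ∉ es) (uv : Joins i u v) (u≁v : ¬ Connected es u v)
    where

    Sides : Pred E 0ℓ
    Sides = EdgeIn es u ∪ EdgeIn es v

    u-side? : Decidable (λ e → Connected es u (src e))
    u-side? e = connected? es u (src e)

    v-side⊆∁u-side : EdgeIn es v ⊆ ∁ (λ e → Connected es u (src e))
    v-side⊆∁u-side (_ , v∼e) u∼e = components-disjoint u≁v (u∼e , v∼e)

    sides⊆∁i : Sides ⊆ ∁ (_≡ i)
    sides⊆∁i (inj₁ (e∈es , _)) refl = i∉es e∈es
    sides⊆∁i (inj₂ (e∈es , _)) refl = i∉es e∈es

    avoids-v : ∀ {τ} → Orientation (EdgeIn es u) τ → ∀ {y} → Connected es v y → Avoids (EdgeIn es u) τ y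
    avoids-v o v∼y d refl = components-disjoint u≁v (orientation-image o d , v∼y)

    avoids-u : ∀ {τ} → Orientation (EdgeIn es v) τ → ∀ {y} → Connected es u y → Avoids (EdgeIn es v) τ y
    avoids-u o u∼y d refl = components-disjoint u≁v (u∼y , orientation-image o d)

    glue : (E → Fin n) → (E → Fin n) → E → Fin n
    glue = merge u-side?

    glue-orientation : ∀ {τᵤ τᵥ} → Orientation (EdgeIn es u) τᵤ → Orientation (EdgeIn es v) τᵥ →
      Orientation Sides (glue τᵤ τᵥ)
    glue-orientation oᵤ oᵥ = merge-orientation u-side? proj₂ v-side⊆∁u-side oᵤ oᵥ
      λ dᵤ dᵥ τᵤ≡τᵥ → avoids-u oᵥ (orientation-image oᵤ dᵤ) dᵥ (sym τᵤ≡τᵥ)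

    glue-≡ᵥ : ∀ {τᵤ τᵥ e} → EdgeIn es v e → glue τᵤ τᵥ e ≡ τᵥ e
    glue-≡ᵥ = merge-≡₂ {D₁ = EdgeIn es u} u-side? proj₂ v-side⊆∁u-side

    glue-avoids : ∀ {τᵤ τᵥ x} → Avoids (EdgeIn es u) τᵤ x → Avoids (EdgeIn es v) τᵥ x →
      Avoids Sides (glue τᵤ τᵥ) x
    glue-avoids = merge-avoids u-side? proj₂ v-side⊆∁u-side

    glue-agree : ∀ {τᵤ τᵥ τ} → Agree (EdgeIn es u) τᵤ τ → Agree (EdgeIn es v) τᵥ τ →
      Agree Sides (glue τᵤ τᵥ) τ
    glue-agree = merge-agree u-side? proj₂ v-side⊆∁u-side

    ∣∣-across : ∀ {w} → Connected (i ∷ es) w u →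
      ∣ connected? (i ∷ es) w ∣ ≡ ∣ connected? es u ∣ + ∣ connected? es v ∣
    ∣∣-across {w} w∼u = ∣∣-∪ (connected? es u) (connected? es v) (connected? (i ∷ es) w)
      (component-∷-bridge uv w∼u) (components-disjoint u≁v)

    #edges-across : ∀ {w} → Connected (i ∷ es) w u →
      length (edges (i ∷ es) w) ≡ suc (length (edges es u) + length (edges es v))
    #edges-across {w} w∼u = trans (#edges-∷-inside (w∼u ◅◅ connected-∷-src uv))
      (cong suc (#within-∪ (connected? es u) (connected? es v) (connected? (i ∷ es) w)
                  (component-∷-bridge uv w∼u) (components-disjoint u≁v) es))

    tree-sides : ∀ {w} → Connected (i ∷ es) w u → IsTree (i ∷ es) w → IsTree es u × IsTree es v
    tree-sides {w} w∼u tree = +-tight (∣component∣≤1+#edges es u) (∣component∣≤1+#edges es v) (begin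
      ∣ connected? es u ∣ + ∣ connected? es v ∣               ≡⟨ ∣∣-across w∼u ⟨
      ∣ connected? (i ∷ es) w ∣                               ≡⟨ tree ⟩
      suc (length (edges (i ∷ es) w))                        ≡⟨ cong suc (#edges-across w∼u) ⟩
      suc (suc (length (edges es u) + length (edges es v)))   ≡⟨ cong suc (+-suc _ _) ⟨
      suc (length (edges es u)) + suc (length (edges es v))   ∎)
      where open ≡-Reasoning

    unicyclic-sides : ∀ {w} → Connected (i ∷ es) w u → IsUnicyclic (i ∷ es) w →
      (IsTree es u × IsUnicyclic es v) ⊎ (IsUnicyclic es u × IsTree es v)
    unicyclic-sides {w} w∼u unicyclic = +-tight-suc (∣component∣≤1+#edges es u) (∣component∣≤1+#edges es v)
      (trans (sym (∣∣-across w∼u)) (trans unicyclic (#edges-across w∼u)))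

    -- The bridge points into the side not containing the root x: otherwise the u side would have
    -- to avoid both x and u.
    tree-across : ∀ {w x} → Unique es → Connected (i ∷ es) w u → Connected es u x → IsTree es u →
      ∃ (UniqueOrientationAvoiding (EdgeIn es u) x) → ∃ (UniqueOrientationAvoiding (EdgeIn es v) v) →
      ∃ (UniqueOrientationAvoiding (EdgeIn (i ∷ es) w) x)
    tree-across {w} {x} !es w∼u u∼x tree-u (τᵤ , Tᵤ) (τᵥ , Tᵥ) =
      τ , uniqueOrientationAvoiding-≐ (≐-sym (edgeIn-∷-bridge uv w∼u)) record
        { orientation = orient-toward sides⊆∁i v-end (glue-orientation oᵤ oᵥ)
                          (glue-avoids (avoids-v oᵤ ε) (avoids-root Tᵥ))
        ; avoids-root = merge-avoids (_≟ᴱ i) id sides⊆∁i (λ { refl refl → u≁v u∼x })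
                          (glue-avoids (avoids-root Tᵤ) (avoids-u oᵥ u∼x))
        ; unique      = τ-unique }
      where
      open UniqueOrientationAvoiding
      oᵤ = orientation Tᵤ
      oᵥ = orientation Tᵥ
      τ = glue τᵤ τᵥ [ i ↦ v ]
      v-end : v ≡ src i ⊎ v ≡ tgt i
      v-end = [ (λ (_ , v≡t) → inj₂ v≡t) , (λ (_ , v≡s) → inj₁ v≡s) ] uv
      τ-unique : ∀ {τ′} → Orientation ((_≡ i) ∪ Sides) τ′ → Avoids ((_≡ i) ∪ Sides) τ′ x →
        Agree ((_≡ i) ∪ Sides) τ τ′
      τ-unique {τ′} o′ avoids-x with orientation-drop sides⊆∁i o′ | endpoint-joins uv (endpoint o′ (inj₁ refl))
      ... | o-sides , avoids-τ′i | inj₂ τ′i≡v = toward-agree sides⊆∁i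
        (glue-agree (unique Tᵤ (orientation-⊆ inj₁ o-sides) (avoids-x ∘ inj₂ ∘ inj₁))
                    (unique Tᵥ (orientation-⊆ inj₂ o-sides) λ d → subst (_ ≢_) τ′i≡v (avoids-τ′i (inj₂ d))))
        τ′i≡v
      ... | o-sides , avoids-τ′i | inj₁ τ′i≡u = ⊥-elim (1+n≰n (subst (2 + length (edges es u) ≤_) tree-u
        (orientation-bound !es (orientation-⊆ inj₁ o-sides) ((x≢u ∷ []) ∷ [] ∷ [])
          λ { (here refl)         → u∼x , avoids-x ∘ inj₂ ∘ inj₁
            ; (there (here refl)) → ε , λ d → subst (_ ≢_) τ′i≡u (avoids-τ′i (inj₁ d)) })))
        where
        x≢u : x ≢ u
        x≢u x≡u = avoids-x (inj₁ refl) (trans τ′i≡u (sym x≡u))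

    -- The bridge points into the tree side: otherwise the unicyclic side would have to avoid v.
    unicyclic-across : ∀ {w} → Unique es → Connected (i ∷ es) w u → IsUnicyclic es v →
      ∃ (UniqueOrientationAvoiding (EdgeIn es u) u) → TwoOrientations (EdgeIn es v) →
      TwoOrientations (EdgeIn (i ∷ es) w)
    unicyclic-across !es w∼u unicyclic-v (τᵤ , Tᵤ) Cᵥ = twoOrientations-≐ (≐-sym (edgeIn-∷-bridge uv w∼u)) record
      { τ₁           = τ (τ₁ Cᵥ)
      ; τ₂           = τ (τ₂ Cᵥ)
      ; orientation₁ = oriented (orientation₁ Cᵥ)
      ; orientation₂ = oriented (orientation₂ Cᵥ)
      ; distinct     = let e , d , τ₁≢τ₂ = distinct Cᵥ in
                       e , inj₂ (inj₂ d) , λ eq → τ₁≢τ₂ (trans (sym (on-v-side d)) (trans eq (on-v-side d)))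
      ; exhaustive   = τ-exhaustive }
      where
      open UniqueOrientationAvoiding
      open TwoOrientations
      τ : (E → Fin n) → E → Fin n
      τ τᵥ = glue τᵤ τᵥ [ i ↦ u ]
      u-end : u ≡ src i ⊎ u ≡ tgt i
      u-end = [ (λ (u≡s , _) → inj₁ u≡s) , (λ (u≡t , _) → inj₂ u≡t) ] uv
      oriented : ∀ {τᵥ} → Orientation (EdgeIn es v) τᵥ → Orientation ((_≡ i) ∪ Sides) (τ τᵥ)
      oriented oᵥ = orient-toward sides⊆∁i u-end (glue-orientation (orientation Tᵤ) oᵥ)
                                  (glue-avoids (avoids-root Tᵤ) (avoids-u oᵥ ε))
      on-v-side : ∀ {τᵥ e} → EdgeIn es v e → τ τᵥ e ≡ τᵥ e
      on-v-side d = trans (update-≢ _ u (sides⊆∁i (inj₂ d))) (glue-≡ᵥ d)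
      τ-exhaustive : ∀ {τ′} → Orientation ((_≡ i) ∪ Sides) τ′ →
        Agree _ (τ (τ₁ Cᵥ)) τ′ ⊎ Agree _ (τ (τ₂ Cᵥ)) τ′
      τ-exhaustive {τ′} o′ with orientation-drop sides⊆∁i o′ | endpoint-joins uv (endpoint o′ (inj₁ refl))
      ... | o-sides , avoids-τ′i | inj₁ τ′i≡u = Sum.map extend extend (exhaustive Cᵥ (orientation-⊆ inj₂ o-sides))
        where
        extend : ∀ {τᵥ} → Agree (EdgeIn es v) τᵥ τ′ → Agree ((_≡ i) ∪ Sides) (τ τᵥ) τ′
        extend agree-v = toward-agree sides⊆∁i (glue-agree
          (unique Tᵤ (orientation-⊆ inj₁ o-sides) λ d → subst (_ ≢_) τ′i≡u (avoids-τ′i (inj₁ d))) agree-v) τ′i≡u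
      ... | o-sides , avoids-τ′i | inj₂ τ′i≡v = ⊥-elim (1+n≰n (subst (1 + length (edges es v) ≤_) unicyclic-v
        (orientation-bound !es (orientation-⊆ inj₂ o-sides) ([] ∷ [])
          λ { (here refl) → ε , λ d → subst (_ ≢_) τ′i≡v (avoids-τ′i (inj₂ d)) })))

  tree-orientation : ∀ {es} → Unique es → ∀ {w} → IsTree es w →
    ∀ {x} → Connected es w x → ∃ (UniqueOrientationAvoiding (EdgeIn es w) x)
  tree-orientation {[]} _ _ {x} _ = (λ _ → x) , record
    { orientation = record { endpoint = λ () ; injective = λ () } ; avoids-root = λ () ; unique = λ _ _ () }
  tree-orientation {i ∷ es} (i∉es ∷ !es) {w} tree {x} w∼x
    with connected? (i ∷ es) w (src i) | connected? es (src i) (tgt i)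
  ... | no w≁i | _ = Data.Product.map₂ (uniqueOrientationAvoiding-≐ (≐-sym (edgeIn-∷-outside w≁i)))
    (tree-orientation !es tree′ (connected-∷-outside w≁i w∼x))
    where
    tree′ : IsTree es w
    tree′ = trans (sym (∣∣-cong _ _ (component-∷-outside w≁i))) (trans tree (cong suc (#edges-∷-outside w≁i)))
  ... | yes w∼i | yes s∼t = ⊥-elim (1+n≰n (begin
    suc (length (edges (i ∷ es) w))   ≡⟨ tree ⟨
    ∣ connected? (i ∷ es) w ∣         ≡⟨ ∣∣-cong _ _ (component-∷-cycle s∼t) ⟩
    ∣ connected? es w ∣               ≤⟨ ∣component∣≤1+#edges es w ⟩
    suc (length (edges es w))         ≡⟨ #edges-∷-cycle w∼i s∼t ⟨
    length (edges (i ∷ es) w)         ∎))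
    where open ≤-Reasoning
  ... | yes w∼i | no s≁t =
    [ across (inj₁ (refl , refl)) s≁t w∼i
    , across (inj₂ (refl , refl)) (s≁t ∘ connected-sym) (w∼i ◅◅ connected-edge (here refl) (inj₁ (refl , refl))) ]
    (connected-∷-bridge (inj₁ (refl , refl)) (connected-sym w∼i ◅◅ w∼x))
    where
    across : ∀ {u v} → Joins i u v → ¬ Connected es u v → Connected (i ∷ es) w u → Connected es u x →
      ∃ (UniqueOrientationAvoiding (EdgeIn (i ∷ es) w) x)
    across uv u≁v w∼u u∼x = tree-across !es w∼u u∼x (proj₁ sides)
        (tree-orientation !es (proj₁ sides) u∼x) (tree-orientation !es (proj₂ sides) ε)
      where
      open Bridge (All.All¬⇒¬Any i∉es) uv u≁v
      sides = tree-sides w∼u tree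

  unicyclic-orientations : ∀ {es} → Unique es → Loopless es → ∀ {w} → IsUnicyclic es w →
    TwoOrientations (EdgeIn es w)
  unicyclic-orientations {[]} _ _ {w} unicyclic = ⊥-elim (1+n≰n (subst (1 ≤_) unicyclic
    (length≤∣∣ (connected? [] w) ([] ∷ []) λ { (here refl) → ε })))
  unicyclic-orientations {i ∷ es} (i∉es ∷ !es) loopless {w} unicyclic
    with connected? (i ∷ es) w (src i) | connected? es (src i) (tgt i)
  ... | no w≁i | _ = twoOrientations-≐ (≐-sym (edgeIn-∷-outside w≁i))
    (unicyclic-orientations !es (loopless ∘ there)
      (trans (sym (∣∣-cong _ _ (component-∷-outside w≁i))) (trans unicyclic (#edges-∷-outside w≁i))))
  ... | yes w∼i | yes s∼t = twoOrientations-≐ (≐-sym (edgeIn-∷-cycle w∼i s∼t))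
    (cycle-orientations (λ (e∈es , _) e≡i → All.lookup i∉es e∈es (sym e≡i)) (loopless (here refl))
      (tree-orientation !es tree ∘ [ (λ { refl → w∼s }) , (λ { refl → w∼s ◅◅ s∼t }) ]))
    where
    w∼s = connected-∷-cycle s∼t w∼i
    tree : IsTree es w
    tree = trans (sym (∣∣-cong _ _ (component-∷-cycle s∼t))) (trans unicyclic (#edges-∷-cycle w∼i s∼t))
  ... | yes w∼i | no s≁t with Bridge.unicyclic-sides (All.All¬⇒¬Any i∉es) (inj₁ (refl , refl)) s≁t w∼i unicyclic
  ...   | inj₁ (tree-s , unicyclic-t) =
    Bridge.unicyclic-across (All.All¬⇒¬Any i∉es) (inj₁ (refl , refl)) s≁t !es w∼i unicyclic-t
      (tree-orientation !es tree-s ε) (unicyclic-orientations !es (loopless ∘ there) unicyclic-t)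
  ...   | inj₂ (unicyclic-s , tree-t) =
    Bridge.unicyclic-across (All.All¬⇒¬Any i∉es) (inj₂ (refl , refl)) (s≁t ∘ connected-sym) !es
      (w∼i ◅◅ connected-edge (here refl) (inj₁ (refl , refl))) unicyclic-s
      (tree-orientation !es tree-t ε) (unicyclic-orientations !es (loopless ∘ there) unicyclic-s)

  record TreeAndUnicyclic (es : List E) : Set where
    field
      t c       : Fin n
      t≁c       : ¬ Connected es t c
      cover     : ∀ y → Connected es t y ⊎ Connected es c y
      sizes     : ∣ connected? es t ∣ + ∣ connected? es c ∣ ≡ n
      tree      : IsTree es t
      unicyclic : IsUnicyclic es c

  two-components : ∀ {es u v} → suc (length es) ≡ n → ¬ Connected es u v →
    (∀ y → Connected es u y ⊎ Connected es v y) → TreeAndUnicyclic es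
  two-components {es} {u} {v} 1+#es≡n u≁v cover = choose
    (+-tight-suc (∣component∣≤1+#edges es u) (∣component∣≤1+#edges es v)
                 (trans sizes (trans (sym 1+#es≡n) (cong suc #es))))
    where
    everything : Relation.Unary.U ≐ Connected es u ∪ Connected es v
    everything = (λ {y} _ → cover y) , _
    sizes : ∣ connected? es u ∣ + ∣ connected? es v ∣ ≡ n
    sizes = trans (sym (∣∣-∪ (connected? es u) (connected? es v) (λ _ → yes _) everything (components-disjoint u≁v)))
                  (trans (cong length (filter-all (λ _ → yes _) (All.universal _ (allFin n)))) (length-tabulate id))
    #es : length es ≡ length (edges es u) + length (edges es v)
    #es = trans (sym (cong length (filter-all (λ _ → yes _) (All.universal _ es))))
                (#within-∪ (connected? es u) (connected? es v) (λ _ → yes _) everything (components-disjoint u≁v) es)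
    choose : (IsTree es u × IsUnicyclic es v) ⊎ (IsUnicyclic es u × IsTree es v) → TreeAndUnicyclic es
    choose (inj₁ (tree-u , unicyclic-v)) = record
      { t = u ; c = v ; t≁c = u≁v ; cover = cover ; sizes = sizes ; tree = tree-u ; unicyclic = unicyclic-v }
    choose (inj₂ (unicyclic-u , tree-v)) = record
      { t = v ; c = u ; t≁c = u≁v ∘ connected-sym ; cover = Sum.swap ∘ cover
      ; sizes = trans (+-comm ∣ connected? es v ∣ _) sizes ; tree = tree-v ; unicyclic = unicyclic-u }

  module TreeAndUnicyclicOrientations {es} (!es : Unique es) (loopless : Loopless es) (G : TreeAndUnicyclic es)
    where

    open TreeAndUnicyclic G
    open TwoOrientations (unicyclic-orientations !es loopless unicyclic)
    open UniqueOrientationAvoiding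

    -- The value for roots outside the tree is never used: no orientation avoids such a root.
    rootedAt : Fin n → E → Fin n
    rootedAt x with connected? es t x
    ... | yes t∼x = proj₁ (tree-orientation !es tree t∼x)
    ... | no _    = λ _ → x

    rootedAt-unique : ∀ {x} → Connected es t x → UniqueOrientationAvoiding (EdgeIn es t) x (rootedAt x)
    rootedAt-unique {x} t∼x with connected? es t x
    ... | yes t∼x′ = proj₂ (tree-orientation !es tree t∼x′)
    ... | no t≁x   = ⊥-elim (t≁x t∼x)

    cyclePart : Bool → E → Fin n
    cyclePart true  = τ₁
    cyclePart false = τ₂

    cyclePart-orientation : ∀ k → Orientation (EdgeIn es c) (cyclePart k)
    cyclePart-orientation true  = orientation₁
    cyclePart-orientation false = orientation₂

    t-side? : Decidable (λ e → Connected es t (src e))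
    t-side? e = connected? es t (src e)

    c-side⊆∁t-side : EdgeIn es c ⊆ ∁ (λ e → Connected es t (src e))
    c-side⊆∁t-side (_ , c∼e) t∼e = t≁c (t∼e ◅◅ connected-sym c∼e)

    edges-split : (_∈ es) ⊆ EdgeIn es t ∪ EdgeIn es c
    edges-split {e} e∈es = Sum.map (e∈es ,_) (e∈es ,_) (cover (src e))

    orientationFrom : Fin n → Bool → E → Fin n
    orientationFrom x k = merge t-side? (rootedAt x) (cyclePart k)

    orientationFrom-valid : ∀ {x} k → Connected es t x →
      Orientation (_∈ es) (orientationFrom x k) × Avoids (_∈ es) (orientationFrom x k) x
    orientationFrom-valid {x} k t∼x =
      orientation-⊆ edges-split (merge-orientation t-side? proj₂ c-side⊆∁t-side (orientation T) oC apart) ,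
      merge-avoids t-side? proj₂ c-side⊆∁t-side (avoids-root T) outside-c ∘ edges-split
      where
      T = rootedAt-unique t∼x
      oC = cyclePart-orientation k
      apart : ∀ {e e′} → EdgeIn es t e → EdgeIn es c e′ → rootedAt x e ≢ cyclePart k e′
      apart d d′ eq =
        t≁c (subst (Connected es t) eq (orientation-image (orientation T) d) ◅◅ connected-sym (orientation-image oC d′))
      outside-c : Avoids (EdgeIn es c) (cyclePart k) x
      outside-c d refl = t≁c (t∼x ◅◅ connected-sym (orientation-image oC d))

    orientation-complete : ∀ {x τ} → Orientation (_∈ es) τ → Avoids (_∈ es) τ x →
      Connected es t x × ∃ λ k → Agree (_∈ es) (orientationFrom x k) τ
    orientation-complete {x} {τ} o avoids-x with cover x
    ... | inj₂ c∼x = ⊥-elim (1+n≰n (subst (1 + length (edges es c) ≤_) unicyclic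
      (orientation-bound !es (orientation-⊆ proj₁ o) ([] ∷ []) λ { (here refl) → c∼x , avoids-x ∘ proj₁ })))
    ... | inj₁ t∼x = t∼x , agree (exhaustive (orientation-⊆ proj₁ o))
      where
      agree-t : Agree (EdgeIn es t) (rootedAt x) τ
      agree-t = unique (rootedAt-unique t∼x) (orientation-⊆ proj₁ o) (avoids-x ∘ proj₁)
      merged : ∀ k → Agree (EdgeIn es c) (cyclePart k) τ → Agree (_∈ es) (orientationFrom x k) τ
      merged k agree-c e∈es = merge-agree t-side? proj₂ c-side⊆∁t-side agree-t agree-c (edges-split e∈es)
      agree : Agree (EdgeIn es c) τ₁ τ ⊎ Agree (EdgeIn es c) τ₂ τ → ∃ λ k → Agree (_∈ es) (orientationFrom x k) τ
      agree (inj₁ agree-c) = true  , merged true agree-c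
      agree (inj₂ agree-c) = false , merged false agree-c

    orientationFrom-distinct : ∃ λ e → e ∈ es × ∀ x → orientationFrom x true e ≢ orientationFrom x false e
    orientationFrom-distinct = let e , d , τ₁≢τ₂ = distinct in e , proj₁ d , λ x eq →
      τ₁≢τ₂ (trans (sym (on-c-side x {true} d)) (trans eq (on-c-side x {false} d)))
      where
      on-c-side : ∀ x {k e} → EdgeIn es c e → orientationFrom x k e ≡ cyclePart k e
      on-c-side x = merge-≡₂ {D₁ = EdgeIn es t} t-side? proj₂ c-side⊆∁t-side {τ₁ = rootedAt x}

-- The graph G_W

ends : List (Fin 8) → Fin 8 × Fin 8
ends (u ∷ v ∷ _) = u , v
ends _           = Fin.zero , Fin.zero

ends-length≡2 : ∀ {xs} → length xs ≡ 2 → xs ≡ proj₁ (ends xs) ∷ proj₂ (ends xs) ∷ []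
ends-length≡2 {_ ∷ _ ∷ []} refl = refl

module CubeGraph (W : Cubes8) where

  labelsEdge? : Decidable (λ i → length (shared W i) ≡ 2)
  labelsEdge? i = length (shared W i) Data.Nat.≟ 2

  sharesCorner? : ∀ i → Decidable (λ j → lookup BaCorners j ∈ᵛ corners (lookup W i))
  sharesCorner? i j = lookup BaCorners j ∈ᵛ? corners (lookup W i)

  edgeCubes : List (Fin 8)
  edgeCubes = filter labelsEdge? (allFin 8)

  -- The ends of the edge labelled by cube i (junk unless i ∈ edgeCubes).
  src tgt : Fin 8 → Fin 8
  src i = proj₁ (ends (shared W i))
  tgt i = proj₂ (ends (shared W i))

  open Multigraph Fin._≟_ src tgt public

  !edgeCubes : Unique edgeCubes
  !edgeCubes = filter⁺ labelsEdge? (allFin⁺ 8)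

  shared-edge : ∀ {i} → i ∈ edgeCubes → shared W i ≡ src i ∷ tgt i ∷ []
  shared-edge i∈ = ends-length≡2 (proj₂ (∈-filter⁻ labelsEdge? {xs = allFin 8} i∈))

  edge⁻ : ∀ {i u v} → Defs.Edge W i u v → i ∈ edgeCubes × u ≡ src i × v ≡ tgt i
  edge⁻ {i} uv =
    ∈-filter⁺ labelsEdge? (∈-allFin i) (cong length uv) , cong (proj₁ ∘ ends) (sym uv) , cong (proj₂ ∘ ends) (sym uv)

  adjacentExcept⁻ : ∀ {allowed x y} → AdjExcept W allowed x y → ∃ λ i → allowed i × i ∈ edgeCubes × Joins i x y
  adjacentExcept⁻ (i , ok , inj₁ xy) = let i∈ , x≡s , y≡t = edge⁻ xy in i , ok , i∈ , inj₁ (x≡s , y≡t)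
  adjacentExcept⁻ (i , ok , inj₂ yx) = let i∈ , y≡s , x≡t = edge⁻ yx in i , ok , i∈ , inj₂ (x≡t , y≡s)

  adjacent⁻ : ∀ {x y} → Defs.Adj W x y → Adjacent edgeCubes x y
  adjacent⁻ xy = let i , _ , i∈ , joins = adjacentExcept⁻ xy in i , i∈ , joins

  adjacent⁺ : ∀ {x y} → Adjacent edgeCubes x y → Defs.Adj W x y
  adjacent⁺ (i , i∈ , inj₁ (refl , refl)) = i , _ , inj₁ (shared-edge i∈)
  adjacent⁺ (i , i∈ , inj₂ (refl , refl)) = i , _ , inj₂ (shared-edge i∈)

  loopless : Loopless edgeCubes
  loopless {i} i∈ with subst Unique (shared-edge i∈) (filter⁺ (sharesCorner? i) (allFin⁺ 8))
  ... | (s≢t ∷ []) ∷ _ = s≢t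

  corner⇒shared : ∀ {i j} → lookup BaCorners j ∈ᵛ corners (lookup W i) → j ∈ shared W i
  corner⇒shared {i} {j} = ∈-filter⁺ (sharesCorner? i) (∈-allFin j)

  shared⇒corner : ∀ {i j} → j ∈ shared W i → lookup BaCorners j ∈ᵛ corners (lookup W i)
  shared⇒corner {i} = proj₂ ∘ ∈-filter⁻ (sharesCorner? i) {xs = allFin 8}

  edge-corner⁻ : ∀ {i j} → i ∈ edgeCubes → lookup BaCorners j ∈ᵛ corners (lookup W i) → j ≡ src i ⊎ j ≡ tgt i
  edge-corner⁻ {j = j} i∈ corner with subst (j ∈_) (shared-edge i∈) (corner⇒shared corner)
  ... | here j≡s         = inj₁ j≡s
  ... | there (here j≡t) = inj₂ j≡t

  edge-corner⁺ : ∀ {i j} → i ∈ edgeCubes → j ≡ src i ⊎ j ≡ tgt i → lookup BaCorners j ∈ᵛ corners (lookup W i)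
  edge-corner⁺ {i} {j} i∈ end = shared⇒corner (subst (j ∈_) (sym (shared-edge i∈)) (ends-∈ end))
    where
    ends-∈ : j ≡ src i ⊎ j ≡ tgt i → j ∈ src i ∷ tgt i ∷ []
    ends-∈ (inj₁ j≡s) = here j≡s
    ends-∈ (inj₂ j≡t) = there (here j≡t)

  module WithBa {ba : Fin 8} (isBa : IsBa (lookup W ba)) (seven : numEdges W ≡ 7) where

    ba-corner : ∀ j → lookup BaCorners j ∈ᵛ corners (lookup W ba)
    ba-corner j = proj₂ (isBa (lookup BaCorners j)) (∈-lookup j BaCorners)

    ba∉edgeCubes : ba ∉ edgeCubes
    ba∉edgeCubes ba∈ with trans (cong length (sym shared-ba)) (proj₂ (∈-filter⁻ labelsEdge? {xs = allFin 8} ba∈))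
      where
      shared-ba : shared W ba ≡ allFin 8
      shared-ba = filter-all (sharesCorner? ba) (All.universal ba-corner (allFin 8))
    ... | ()

    edge≢ba : ∀ {i} → i ∈ edgeCubes → i ≢ ba
    edge≢ba i∈ refl = ba∉edgeCubes i∈

    -- G_W has seven edges and Ba labels none of them, so each of the seven other cubes labels one.
    edge-or-ba : ∀ i → i ≡ ba ⊎ i ∈ edgeCubes
    edge-or-ba i with i Fin.≟ ba | i ∈? edgeCubes
    ... | yes i≡ba | _      = inj₁ i≡ba
    ... | no _     | yes i∈ = inj₂ i∈
    ... | no i≢ba  | no i∉  = ⊥-elim (1+n≰n (subst (λ m → 2 + m ≤ 8) seven
      (length≤∣∣ {P = Relation.Unary.U} (λ _ → yes _) {zs = ba ∷ i ∷ edgeCubes} distinct _)))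
      where
      distinct : Unique (ba ∷ i ∷ edgeCubes)
      distinct = ((i≢ba ∘ sym) ∷ All.¬Any⇒All¬ _ ba∉edgeCubes) ∷ All.¬Any⇒All¬ _ i∉ ∷ !edgeCubes

    solution⇒orientation : ∀ {σ} → IsSolution W σ →
      Orientation (_∈ edgeCubes) (lookup σ) × Avoids (_∈ edgeCubes) (lookup σ) (lookup σ ba)
    solution⇒orientation (σ-injective , _ , σ-corner) =
      record { endpoint = λ {i} i∈ → edge-corner⁻ i∈ (σ-corner i) ; injective = λ _ _ → σ-injective _ _ } ,
      λ i∈ σi≡σba → edge≢ba i∈ (σ-injective _ _ σi≡σba)

    orientation⇒solution : ∀ {σ} → Orientation (_∈ edgeCubes) (lookup σ) →
      Avoids (_∈ edgeCubes) (lookup σ) (lookup σ ba) → IsSolution W σ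
    orientation⇒solution {σ} o avoids-σba = σ-injective , injective⇒surjective (lookup σ) σ-injective , σ-corner
      where
      σ-injective : ∀ i j → lookup σ i ≡ lookup σ j → i ≡ j
      σ-injective i j σi≡σj with edge-or-ba i | edge-or-ba j
      ... | inj₁ refl | inj₁ refl = refl
      ... | inj₁ refl | inj₂ j∈   = ⊥-elim (avoids-σba j∈ (sym σi≡σj))
      ... | inj₂ i∈   | inj₁ refl = ⊥-elim (avoids-σba i∈ σi≡σj)
      ... | inj₂ i∈   | inj₂ j∈   = injective o i∈ j∈ σi≡σj
      σ-corner : ∀ i → lookup BaCorners (lookup σ i) ∈ᵛ corners (lookup W i)
      σ-corner i with edge-or-ba i
      ... | inj₁ refl = ba-corner (lookup σ i)
      ... | inj₂ i∈   = edge-corner⁺ i∈ (endpoint o i∈)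

    treeAndUnicyclic : TwoComponents W → TreeAndUnicyclic edgeCubes
    treeAndUnicyclic (u , v , u≁v , cover) = two-components (cong suc seven) (u≁v ∘ Star.map adjacent⁺)
      (Sum.map (Star.map adjacent⁻) (Star.map adjacent⁻) ∘ cover)

    module _ (G : TreeAndUnicyclic edgeCubes) where

      open TreeAndUnicyclic G
      open TreeAndUnicyclicOrientations !edgeCubes loopless G
      open Removal (Fin._≟_ {8}) using (_without_; without-∈)

      #tree-edges≤5 : length (edges edgeCubes t) ≤ 5
      #tree-edges≤5 = m+n≤o⇒m≤o∸n _ (s≤s⁻¹ (begin
        suc (length (edges edgeCubes t)) + 2                           ≤⟨ +-monoʳ-≤ _ (unicyclic-size loopless unicyclic) ⟩
        suc (length (edges edgeCubes t)) + ∣ connected? edgeCubes c ∣  ≡⟨ cong (_+ ∣ connected? edgeCubes c ∣) tree ⟨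
        ∣ connected? edgeCubes t ∣ + ∣ connected? edgeCubes c ∣        ≡⟨ sizes ⟩
        8                                                              ∎))
        where open ≤-Reasoning

      tree-edges-are-bridges : ∀ i u v → Defs.Edge W i u v → Defs.Connected W t u →
        ¬ Star (AdjExcept W (λ j → j ≢ i)) u v
      tree-edges-are-bridges i u v uv t∼u path with edge⁻ uv
      ... | i∈ , refl , refl = tree-edge-bridge !edgeCubes tree (i∈ , Star.map adjacent⁻ t∼u) (Star.map avoiding-i path)
        where
        avoiding-i : ∀ {x y} → AdjExcept W (λ j → j ≢ i) x y → Adjacent (edgeCubes without i) x y
        avoiding-i xy = let j , j≢i , j∈ , joins = adjacentExcept⁻ xy in j , without-∈ j∈ j≢i , joins

      tree-edges : ∀ i → (i ∈ edges edgeCubes t → Defs.EdgeIn W t i) × (Defs.EdgeIn W t i → i ∈ edges edgeCubes t)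
      tree-edges i = listed⇒in-tree , in-tree⇒listed
        where
        listed⇒in-tree : i ∈ edges edgeCubes t → Defs.EdgeIn W t i
        listed⇒in-tree i∈tree with ∈-filter⁻ (λ e → connected? edgeCubes t (src e)) {xs = edgeCubes} i∈tree
        ... | i∈ , t∼i = src i , tgt i , shared-edge i∈ , Star.map adjacent⁺ t∼i
        in-tree⇒listed : Defs.EdgeIn W t i → i ∈ edges edgeCubes t
        in-tree⇒listed (_ , _ , uv , t∼u) with edge⁻ uv
        ... | i∈ , refl , refl = ∈-filter⁺ (λ e → connected? edgeCubes t (src e)) i∈ (Star.map adjacent⁻ t∼u)

      componentIsTree : ComponentIsTreeWithEdges W t (length (edges edgeCubes t))
      componentIsTree = tree-edges-are-bridges , edges edgeCubes t , filter⁺ _ !edgeCubes , refl , tree-edges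

      solutionMap : Fin 8 → Bool → Fin 8 → Fin 8
      solutionMap x k = orientationFrom x k [ ba ↦ x ]

      -- Opaque, so that unification does not unfold the vector into its eight entries.
      opaque
        solution : Fin 8 → Bool → Vec (Fin 8) 8
        solution x k = tabulate (solutionMap x k)

        lookup-solution : ∀ x k i → lookup (solution x k) i ≡ solutionMap x k i
        lookup-solution x k = lookup∘tabulate (solutionMap x k)

        solution-ext : ∀ {σ x k} → (∀ i → lookup σ i ≡ solutionMap x k i) → σ ≡ solution x k
        solution-ext {σ} σ≗ = trans (sym (tabulate∘lookup σ)) (tabulate-cong σ≗)

      lookup-solution-ba : ∀ x k → lookup (solution x k) ba ≡ x
      lookup-solution-ba x k = trans (lookup-solution x k ba) (update-≡ (orientationFrom x k) ba x)

      lookup-solution-edge : ∀ x k {i} → i ∈ edgeCubes → lookup (solution x k) i ≡ orientationFrom x k i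
      lookup-solution-edge x k {i} i∈ = trans (lookup-solution x k i) (update-≢ (orientationFrom x k) x (edge≢ba i∈))

      solution-valid : ∀ {x} k → Connected edgeCubes t x → IsSolution W (solution x k)
      solution-valid {x} k t∼x = orientation⇒solution {σ = solution x k} (orientation-agree agree o)
        λ i∈ σi≡σba → avoids-x i∈ (trans (sym (lookup-solution-edge x k i∈)) (trans σi≡σba (lookup-solution-ba x k)))
        where
        o = proj₁ (orientationFrom-valid k t∼x)
        avoids-x = proj₂ (orientationFrom-valid k t∼x)
        agree : Agree (_∈ edgeCubes) (orientationFrom x k) (lookup (solution x k))
        agree i∈ = sym (lookup-solution-edge x k i∈)

      solution-complete : ∀ {σ} → IsSolution W σ → ∃ λ x → Connected edgeCubes t x × ∃ λ k → σ ≡ solution x k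
      solution-complete {σ} σ-solution with solution⇒orientation {σ = σ} σ-solution
      ... | o , avoids with orientation-complete o avoids
      ...   | t∼x , k , agree = lookup σ ba , t∼x , k , solution-ext same
        where
        same : ∀ i → lookup σ i ≡ solutionMap (lookup σ ba) k i
        same i with edge-or-ba i
        ... | inj₁ refl = sym (update-≡ (orientationFrom (lookup σ ba) k) ba (lookup σ ba))
        ... | inj₂ i∈   = trans (sym (agree i∈)) (sym (update-≢ (orientationFrom (lookup σ ba) k) (lookup σ ba) (edge≢ba i∈)))

      solution-injective : ∀ {x x′ k k′} → solution x k ≡ solution x′ k′ → x ≡ x′ × k ≡ k′
      solution-injective {x} {x′} {k} {k′} σ≡σ′ = x≡x′ , same-k k k′ σ≡σ′
        where
        x≡x′ = trans (sym (lookup-solution-ba x k)) (trans (cong (λ σ → lookup σ ba) σ≡σ′) (lookup-solution-ba x′ k′))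
        e = proj₁ orientationFrom-distinct
        e∈ = proj₁ (proj₂ orientationFrom-distinct)
        orientations-equal : ∀ k k′ → solution x k ≡ solution x′ k′ → orientationFrom x k e ≡ orientationFrom x k′ e
        orientations-equal k k′ eq = trans (sym (lookup-solution-edge x k e∈)) (trans (cong (λ σ → lookup σ e) eq)
          (trans (lookup-solution-edge x′ k′ e∈) (cong (λ y → orientationFrom y k′ e) (sym x≡x′))))
        same-k : ∀ k k′ → solution x k ≡ solution x′ k′ → k ≡ k′
        same-k true  true  _  = refl
        same-k false false _  = refl
        same-k true  false eq = ⊥-elim (proj₂ (proj₂ orientationFrom-distinct) x (orientations-equal true false eq))
        same-k false true  eq = ⊥-elim (proj₂ (proj₂ orientationFrom-distinct) x (sym (orientations-equal false true eq)))

      solutionNumber : SolutionNumber≡ W (2 * (length (edges edgeCubes t) + 1))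
      solutionNumber = solutions , !solutions , #solutions , λ σ → listed⇒solution , solution⇒listed
        where
        roots : List (Fin 8)
        roots = filter (connected? edgeCubes t) (allFin 8)
        solutions : List (Vec (Fin 8) 8)
        solutions = cartesianProductWith solution roots (true ∷ false ∷ [])
        !solutions : Unique solutions
        !solutions = cartesianProductWith⁺ {xs = roots} {ys = true ∷ false ∷ []} solution solution-injective
          (filter⁺ (connected? edgeCubes t) (allFin⁺ 8)) (((λ ()) ∷ []) ∷ [] ∷ [])
        #solutions : length solutions ≡ 2 * (length (edges edgeCubes t) + 1)
        #solutions = trans (length-cartesianProductWith solution roots _)
          (trans (cong (_* 2) tree) (trans (*-comm (suc (length (edges edgeCubes t))) 2) (cong (2 *_) (+-comm 1 _))))
        listed⇒solution : ∀ {σ} → σ ∈ solutions → IsSolution W σ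
        listed⇒solution σ∈ with ∈-cartesianProductWith⁻ solution roots _ σ∈
        ... | x , k , x∈roots , _ , refl =
          solution-valid k (proj₂ (∈-filter⁻ (connected? edgeCubes t) {xs = allFin 8} x∈roots))
        solution⇒listed : ∀ {σ} → IsSolution W σ → σ ∈ solutions
        solution⇒listed {σ} σ-solution with solution-complete {σ} σ-solution
        ... | x , t∼x , k , refl =
          ∈-cartesianProductWith⁺ solution (∈-filter⁺ (connected? edgeCubes t) (∈-allFin x) t∼x) (k∈ k)
          where
          k∈ : ∀ k → k ∈ true ∷ false ∷ []
          k∈ true  = here refl
          k∈ false = there (here refl)

lemma12 : (W : Cubes8)
    → (∀ i → IsMacMahon (lookup W i))
    → (∀ i j → i ≢ j → ¬ SameCube (lookup W i) (lookup W j))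
    → (∃ λ i → IsBa (lookup W i))
    → numEdges W ≡ 7
    → TwoComponents W
    → Σ (Fin 8) λ r → Σ ℕ λ k → k ≤ 5
    × ComponentIsTreeWithEdges W r k
    × SolutionNumber≡ W (2 * (k + 1))
lemma12 W _ _ (ba , isBa) seven components =
  t , length (edges edgeCubes t) , #tree-edges≤5 G , componentIsTree G , solutionNumber G
  where
  open CubeGraph W
  open WithBa isBa seven
  G = treeAndUnicyclic components
  open TreeAndUnicyclic G using (t)
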